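{- Let $n \geq 0$ and let $\Sigma$ be any FLB signature. The following problem is decidable: given a first-order $\Sigma$-sentence in prenex form with quantifier prefix in $\exists^*\forall^*$, decide whether it has a model that is a supported $n$-FLB (i.e. whether it is satisfiable modulo $\mathcal{T}^n_{\mathrm{supp}}$).
   Context: First-order logic with equality, without constant symbols. An FLB signature $\Sigma$ consists of: unary relation symbols $\mathsf{P}, \mathsf{P}^\star$; binary relation symbols $\mathsf{Link}, \mathsf{Link}^\star$; a tuple $\mathbf{L}$ of unary relation symbols with a copy $\mathbf{L}^\star$; a tuple $\mathbf{f}$ of unary function symbols; a distinguished unary function symbol $\mathit{parent}$; and a tuple $\mathbf{N}$ of unary relation symbols. For a $\Sigma$-structure $\mathfrak A$, let $G_{\mathfrak A}$ be the directed graph on $\mathrm{dom}(\mathfrak A)$ with an edge $(a, f^{\mathfrak A}(a))$ for every $f \in \mathbf{f}$ and $a$ with $f^{\mathfrak A}(a)\neq a$. $\mathfrak A$ is an FLB if $G_{\mathfrak A}$ is a forest (edges from parent to child), the loop-free graph of $\mathit{parent}^{\mathfrak A}$ is exactly the child-to-parent relation of that forest (roots are mapped to themselves), and $\mathsf{Link}^{\mathfrak A}$, $(\mathsf{Link}^\star)^{\mathfrak A}$ are symmetric and functional. An $n$-FLB is an FLB whose trees have height at most $n$. $\mathfrak A$ is supported if $\mathfrak A \models \forall x.\ \mathsf{P}(x)\vee\mathsf{P}^\star(x)$. $\mathcal{T}^n_{\mathrm{supp}}$ is a finite universal first-order theory whose models are exactly the supported $n$-FLBs. -}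

module Defs where

open import Data.Nat using (ℕ; zero; suc)
open import Data.Fin using (Fin; zero; suc)
open import Data.Product using (Σ; _×_; _,_; ∃-syntax)
open import Data.Sum using (_⊎_)
open import Data.Unit using (⊤)
open import Data.Empty using (⊥)
open import Relation.Nullary using (¬_)
open import Relation.Binary.PropositionalEquality using (_≡_; _≢_)
open import Level using () renaming (suc to lsuc)

-- FLB signatures.  An FLB signature is determined by the lengths of the
-- tuples L (and its copy L⋆), f and N.

record FLBSig : Set where
  field
    nL : ℕ
    nf : ℕ
    nN : ℕ

open FLBSig

data URel (S : FLBSig) : Set where
  P  : URel S
  P⋆ : URel S
  L  : Fin (nL S) → URel S
  L⋆ : Fin (nL S) → URel S
  N  : Fin (nN S) → URel S

data BRel : Set where
  Link  : BRel
  Link⋆ : BRel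

data Fun (S : FLBSig) : Set where
  f      : Fin (nf S) → Fun S
  parent : Fun S

-- First-order syntax with equality, no constants; variables are de Bruijn
-- indices, a formula of type Formula S k has at most k free variables.

data Term (S : FLBSig) (k : ℕ) : Set where
  var : Fin k → Term S k
  app : Fun S → Term S k → Term S k

data Formula (S : FLBSig) : ℕ → Set where
  tt    : ∀ {k} → Formula S k
  ff    : ∀ {k} → Formula S k
  urel  : ∀ {k} → URel S → Term S k → Formula S k
  brel  : ∀ {k} → BRel → Term S k → Term S k → Formula S k
  _≐_   : ∀ {k} → Term S k → Term S k → Formula S k
  ~_    : ∀ {k} → Formula S k → Formula S k
  _∧'_  : ∀ {k} → Formula S k → Formula S k → Formula S k
  _∨'_  : ∀ {k} → Formula S k → Formula S k → Formula S k
  _⇒'_  : ∀ {k} → Formula S k → Formula S k → Formula S k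
  ∀'    : ∀ {k} → Formula S (suc k) → Formula S k
  ∃'    : ∀ {k} → Formula S (suc k) → Formula S k

Sentence : FLBSig → Set
Sentence S = Formula S 0

data IsQF {S : FLBSig} : ∀ {k} → Formula S k → Set where
  tt   : ∀ {k} → IsQF {k = k} tt
  ff   : ∀ {k} → IsQF {k = k} ff
  urel : ∀ {k} R (t : Term S k) → IsQF (urel R t)
  brel : ∀ {k} R (t u : Term S k) → IsQF (brel R t u)
  eq   : ∀ {k} (t u : Term S k) → IsQF (t ≐ u)
  neg  : ∀ {k} {φ : Formula S k} → IsQF φ → IsQF (~ φ)
  and  : ∀ {k} {φ ψ : Formula S k} → IsQF φ → IsQF ψ → IsQF (φ ∧' ψ)
  or   : ∀ {k} {φ ψ : Formula S k} → IsQF φ → IsQF ψ → IsQF (φ ∨' ψ)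
  imp  : ∀ {k} {φ ψ : Formula S k} → IsQF φ → IsQF ψ → IsQF (φ ⇒' ψ)

data IsForallPrenex {S : FLBSig} : ∀ {k} → Formula S k → Set where
  qf  : ∀ {k} {φ : Formula S k} → IsQF φ → IsForallPrenex φ
  all : ∀ {k} {φ : Formula S (suc k)} → IsForallPrenex φ → IsForallPrenex (∀' φ)

data IsExistsForallPrenex {S : FLBSig} : ∀ {k} → Formula S k → Set where
  univ : ∀ {k} {φ : Formula S k} → IsForallPrenex φ → IsExistsForallPrenex φ
  ex   : ∀ {k} {φ : Formula S (suc k)} → IsExistsForallPrenex φ → IsExistsForallPrenex (∃' φ)

record Structure (S : FLBSig) : Set₁ where
  field
    Carrier : Set
    inhabitant : Carrier
    urelI : URel S → Carrier → Set
    brelI : BRel → Carrier → Carrier → Set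
    funI  : Fun S → Carrier → Carrier

module _ {S : FLBSig} (A : Structure S) where
  open Structure A

  evalT : ∀ {k} → (Fin k → Carrier) → Term S k → Carrier
  evalT ρ (var i) = ρ i
  evalT ρ (app g t) = funI g (evalT ρ t)

  extend : ∀ {k} → (Fin k → Carrier) → Carrier → Fin (suc k) → Carrier
  extend ρ a zero = a
  extend ρ a (suc i) = ρ i

  Sat : ∀ {k} → (Fin k → Carrier) → Formula S k → Set
  Sat ρ tt = ⊤
  Sat ρ ff = ⊥
  Sat ρ (urel R t) = urelI R (evalT ρ t)
  Sat ρ (brel R t u) = brelI R (evalT ρ t) (evalT ρ u)
  Sat ρ (t ≐ u) = evalT ρ t ≡ evalT ρ u
  Sat ρ (~ φ) = ¬ Sat ρ φ
  Sat ρ (φ ∧' ψ) = Sat ρ φ × Sat ρ ψ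
  Sat ρ (φ ∨' ψ) = Sat ρ φ ⊎ Sat ρ ψ
  Sat ρ (φ ⇒' ψ) = Sat ρ φ → Sat ρ ψ
  Sat ρ (∀' φ) = (a : Carrier) → Sat (extend ρ a) φ
  Sat ρ (∃' φ) = Σ Carrier (λ a → Sat (extend ρ a) φ)

  Models : Sentence S → Set
  Models φ = Sat (λ ()) φ

  Edge : Carrier → Carrier → Set
  Edge a b = Σ (Fin (nf S)) (λ i → (funI (f i) a ≡ b) × (a ≢ b))

  data Path : Carrier → Carrier → ℕ → Set where
    stop : ∀ {a} → Path a a 0
    step : ∀ {a b c l} → Edge a b → Path b c l → Path a c (suc l)

  IsForest : Set
  IsForest =
    (∀ a b c → Edge b a → Edge c a → b ≡ c) ×
    (∀ a l → ¬ Path a a (suc l))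

  ParentOK : Set
  ParentOK =
    (∀ a b → ((funI parent a ≡ b) × (a ≢ b) → Edge b a)
           × (Edge b a → (funI parent a ≡ b) × (a ≢ b))) ×
    (∀ a → (∀ b → ¬ Edge b a) → funI parent a ≡ a)

  SymFun : BRel → Set
  SymFun R = (∀ a b → brelI R a b → brelI R b a) ×
             (∀ a b c → brelI R a b → brelI R a c → b ≡ c)

  IsFLB : Set
  IsFLB = IsForest × ParentOK × SymFun Link × SymFun Link⋆

  HeightAtMost : ℕ → Set
  HeightAtMost n = ∀ a b → ¬ Path a b (suc n)

  IsNFLB : ℕ → Set
  IsNFLB n = IsFLB × HeightAtMost n

  Supported : Set
  Supported = ∀ a → urelI P a ⊎ urelI P⋆ a

SatModuloTsupp : (n : ℕ) {S : FLBSig} → Sentence S → Set₁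
SatModuloTsupp n {S} φ =
  Σ (Structure S) (λ A → IsNFLB A n × Supported A × Models A φ)

-- Let A be a supported n-FLB satisfying ∃x̄ ∀ȳ ψ, with witnesses ā for x̄.  Every element
-- lies in a tree of height at most n whose root is reached by n + 1 parent steps, and every
-- node of that tree is the value at the root of a word of length n in the functions f
-- (padded with "stay" letters).  So the trees of ā and of one further element form a finite
-- set, closed under f and parent, of size at most (1 + |x̄|) · (1 + |f|)ⁿ.  The substructure
-- on it is again a supported n-FLB, because these conditions are universal, and it satisfies
-- the sentence, because it contains ā and universal formulas pass to substructures.  Hence
-- satisfiability is decided by exhaustive search through the finitely many structures of
-- bounded size.  Equality and the relations of A need not be decidable, so the substructure
-- only exists under double negation; this is enough, since it is used to refute the
-- nonexistence of a small model, which is itself decidable.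

module Submission where

open import Defs
open import Data.Bool using (Bool; true; false; T; T?)
open import Data.Fin using (Fin; zero; suc)
open import Data.Fin.Properties using (any?; ¬Fin0; sequence) renaming (_≟_ to _≟ᶠ_)
open import Data.List using (List; []; _∷_; length; map; allFin; cartesianProductWith)
open import Data.List.Membership.Propositional using (_∈_)
open import Data.List.Membership.Propositional.Properties
  using (∈-allFin; ∈-cartesianProductWith⁺; ∈-cartesianProductWith⁻)
open import Data.List.Properties using (length-++; length-map)
open import Data.List.Relation.Unary.All as All using (All; []; _∷_)
open import Data.List.Relation.Unary.Any using (here; there)
open import Data.Nat using (ℕ; zero; suc; _+_; _*_; _≤_; _<_; z≤n; s≤s)
open import Data.Nat.GeneralisedArithmetic using (fold)
open import Data.Nat.Properties
  using (≤-trans; ≤-reflexive; m≤n⇒m≤1+n; *-monoˡ-≤; _≤?_; ≰⇒>; anyUpTo?)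
open import Data.Product using (Σ; ∃; _×_; _,_; proj₁; proj₂)
open import Data.Product.Function.NonDependent.Propositional using (_×-⇔_)
open import Data.Sum as Sum using (_⊎_; inj₁; inj₂)
open import Data.Sum.Function.Propositional using (_⊎-⇔_)
open import Data.Unit using (tt)
open import Data.Vec using (Vec; []; _∷_; lookup; tabulate)
open import Data.Vec.Properties using (lookup∘tabulate)
open import Effect.Monad using (RawMonad)
open import Function using (_∘_; id; _⇔_; mk⇔; Equivalence)
open import Function.Properties.Equivalence using () renaming (refl to ⇔-refl)
open import Function.Related.TypeIsomorphisms using (→-cong-⇔; ¬-cong-⇔)
open import Level using (0ℓ)
open import Relation.Binary using (DecidableEquality)
open import Relation.Binary.PropositionalEquality
  using (_≡_; _≢_; _≗_; refl; sym; trans; cong; cong₂; subst; subst₂)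
open import Relation.Nullary using (¬_; Dec; yes; no; ¬?; contradiction)
open import Relation.Nullary.Decidable
  using (map′; _×-dec_; _⊎-dec_; _→-dec_; isYes; toWitness; fromWitness; decidable-stable; ¬¬-excluded-middle)
open import Relation.Nullary.Negation using (¬¬-Monad)
open import Relation.Unary using (Pred; Decidable)

open FLBSig
open Equivalence using (to; from)
open RawMonad (¬¬-Monad {0ℓ})

¬¬-Π-Fin : ∀ {k} {P : Fin k → Set} → (∀ i → ¬ ¬ P i) → ¬ ¬ (∀ i → P i)
¬¬-Π-Fin = sequence rawApplicative

¬¬-Π-BRel : {Q : BRel → Set} → (∀ R → ¬ ¬ Q R) → ¬ ¬ (∀ R → Q R)
¬¬-Π-BRel q = do
  qLink ← q Link
  qLink⋆ ← q Link⋆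
  pure λ { Link → qLink ; Link⋆ → qLink⋆ }

module _ {S : FLBSig} where

  ¬¬-Π-URel : {Q : URel S → Set} → (∀ R → ¬ ¬ Q R) → ¬ ¬ (∀ R → Q R)
  ¬¬-Π-URel q = do
    qP ← q P
    qP⋆ ← q P⋆
    qL ← ¬¬-Π-Fin (q ∘ L)
    qL⋆ ← ¬¬-Π-Fin (q ∘ L⋆)
    qN ← ¬¬-Π-Fin (q ∘ N)
    pure λ { P → qP ; P⋆ → qP⋆ ; (L j) → qL j ; (L⋆ j) → qL⋆ j ; (N j) → qN j }

  ¬¬-Π-Fun : {Q : Fun S → Set} → (∀ g → ¬ ¬ Q g) → ¬ ¬ (∀ g → Q g)
  ¬¬-Π-Fun q = do
    qfun ← ¬¬-Π-Fin (q ∘ f)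
    qparent ← q parent
    pure λ { (f j) → qfun j ; parent → qparent }

-- Exhaustive search

Searchable : Set → Set₁
Searchable A = ∀ {Q : Pred A 0ℓ} → Decidable Q → Dec (∃ Q)

∀? : ∀ {A} → Searchable A → ∀ {Q : Pred A 0ℓ} → Decidable Q → Dec (∀ a → Q a)
∀? search Q? = map′ (λ ¬∃¬Q a → decidable-stable (Q? a) (λ ¬Qa → ¬∃¬Q (a , ¬Qa)))
                    (λ ∀Q (a , ¬Qa) → ¬Qa (∀Q a))
                    (¬? (search (¬? ∘ Q?)))

search-Bool : Searchable Bool
search-Bool Q? = map′ (Sum.[ (true ,_) , (false ,_) ])
                      (λ { (true , q) → inj₁ q ; (false , q) → inj₂ q })
                      (Q? true ⊎-dec Q? false)

search-× : ∀ {A B} → Searchable A → Searchable B → Searchable (A × B)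
search-× searchA searchB Q? =
  map′ (λ (a , b , q) → (a , b) , q) (λ ((a , b) , q) → a , b , q)
       (searchA λ a → searchB λ b → Q? (a , b))

search-Vec : ∀ {A} → Searchable A → ∀ k → Searchable (Vec A k)
search-Vec searchA zero Q? = map′ ([] ,_) (λ { ([] , q) → q }) (Q? [])
search-Vec searchA (suc k) Q? =
  map′ (λ (a , v , q) → a ∷ v , q) (λ { (a ∷ v , q) → a , v , q })
       (searchA λ a → search-Vec searchA k λ v → Q? (a ∷ v))

length-cartesianProductWith : ∀ {A B C : Set} (g : A → B → C) xs ys →
  length (cartesianProductWith g xs ys) ≡ length xs * length ys
length-cartesianProductWith g [] ys = refl
length-cartesianProductWith g (x ∷ xs) ys =
  trans (length-++ (map (g x) ys))
        (cong₂ _+_ (length-map (g x) ys) (length-cartesianProductWith g xs ys))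

allVecs : ∀ k m → List (Vec (Fin k) m)
allVecs k zero = [] ∷ []
allVecs k (suc m) = cartesianProductWith _∷_ (allFin k) (allVecs k m)

∈-allVecs : ∀ {k m} (v : Vec (Fin k) m) → v ∈ allVecs k m
∈-allVecs [] = here refl
∈-allVecs (i ∷ v) = ∈-cartesianProductWith⁺ _∷_ (∈-allFin i) (∈-allVecs v)

record InjectiveIndexing {X : Set} (xs : List X) (size : ℕ) : Set where
  field
    index : Fin size → X
    index-injective : ∀ {i j} → index i ≡ index j → i ≡ j
    index-surjective : ∀ {x} → x ∈ xs → ∃ λ i → index i ≡ x
    index-∈ : ∀ i → index i ∈ xs
    size≤length : size ≤ length xs

module _ {X : Set} {y : X} {xs : List X} {size} (I : InjectiveIndexing xs size) where
  open InjectiveIndexing I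

  InjectiveIndexing-∷-indexed : ∃ (λ i → index i ≡ y) → InjectiveIndexing (y ∷ xs) size
  InjectiveIndexing-∷-indexed y-indexed = record
    { index = index
    ; index-injective = index-injective
    ; index-surjective = λ { (here refl) → y-indexed ; (there x∈) → index-surjective x∈ }
    ; index-∈ = there ∘ index-∈
    ; size≤length = m≤n⇒m≤1+n size≤length
    }

  InjectiveIndexing-∷-fresh : ¬ ∃ (λ i → index i ≡ y) → InjectiveIndexing (y ∷ xs) (suc size)
  InjectiveIndexing-∷-fresh y-fresh = record
    { index = index′
    ; index-injective = injective′
    ; index-surjective = λ { (here refl) → zero , refl
                           ; (there x∈) → let (i , e) = index-surjective x∈ in suc i , e }
    ; index-∈ = λ { zero → here refl ; (suc i) → there (index-∈ i) }
    ; size≤length = s≤s size≤length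
    }
    where
    index′ : Fin (suc size) → X
    index′ zero = y
    index′ (suc i) = index i

    injective′ : ∀ {i j} → index′ i ≡ index′ j → i ≡ j
    injective′ {zero} {zero} _ = refl
    injective′ {zero} {suc j} e = contradiction (j , sym e) y-fresh
    injective′ {suc i} {zero} e = contradiction (i , e) y-fresh
    injective′ {suc i} {suc j} e = cong suc (index-injective e)

¬¬-injectiveIndexing : ∀ {X : Set} (xs : List X) → ¬ ¬ ∃ (InjectiveIndexing xs)
¬¬-injectiveIndexing [] = pure (0 , record
  { index = λ () ; index-injective = λ { {()} } ; index-surjective = λ ()
  ; index-∈ = λ () ; size≤length = z≤n })
¬¬-injectiveIndexing (y ∷ xs) = do
  (size , I) ← ¬¬-injectiveIndexing xs
  y-indexed? ← ¬¬-excluded-middle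
  pure (extend-indexing I y-indexed?)
  where
  extend-indexing : ∀ {size} (I : InjectiveIndexing xs size) →
    Dec (∃ λ i → InjectiveIndexing.index I i ≡ y) → ∃ (InjectiveIndexing (y ∷ xs))
  extend-indexing I (yes y-indexed) = _ , InjectiveIndexing-∷-indexed I y-indexed
  extend-indexing I (no y-fresh) = _ , InjectiveIndexing-∷-fresh I y-fresh

module _ {S : FLBSig} (A : Structure S) where
  open Structure A

  ParentStep : Carrier → Carrier → Set
  ParentStep a b = (funI parent a ≡ b) × (a ≢ b)

  Path-zero⇒≡ : ∀ {a b} → Path A a b 0 → a ≡ b
  Path-zero⇒≡ stop = refl

  _▷_ : ∀ {a b c l} → Path A a b l → Edge A b c → Path A a c (suc l)
  stop ▷ e = step e stop
  step e′ p ▷ e = step e′ (p ▷ e)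

  unsnoc : ∀ {a c l} → Path A a c (suc l) → ∃ λ b → Path A a b l × Edge A b c
  unsnoc (step e stop) = _ , stop , e
  unsnoc (step e (step e′ p)) =
    let (b , q , e″) = unsnoc (step e′ p) in b , step e q , e″

  take-Path : ∀ {a b d} → Path A a b d → ∀ {l} → l ≤ d → ∃ λ c → Path A a c l
  take-Path p z≤n = _ , stop
  take-Path (step e p) (s≤s l≤d) = let (c , q) = take-Path p l≤d in c , step e q

  cycle⇒long-paths : ∀ {a l} → Path A a a (suc l) →
                     ∀ {b d} → Path A b a d → ∀ m → ∃ λ c → Path A b c m
  cycle⇒long-paths cyc p zero = _ , stop
  cycle⇒long-paths cyc (step e p) (suc m) =
    let (c , q) = cycle⇒long-paths cyc p m in c , step e q
  cycle⇒long-paths (step e p) stop (suc m) =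
    let (c , q) = cycle⇒long-paths (step e p) p m in c , step e q

  module _ {n} (height : HeightAtMost A n) where

    HeightAtMost⇒acyclic : ∀ a l → ¬ Path A a a (suc l)
    HeightAtMost⇒acyclic a l cyc =
      let (c , q) = cycle⇒long-paths cyc stop (suc n) in height a c q

    HeightAtMost⇒length≤ : ∀ {a b d} → Path A a b d → d ≤ n
    HeightAtMost⇒length≤ {a} {d = d} p with d ≤? n
    ... | yes d≤n = d≤n
    ... | no d≰n = let (c , q) = take-Path p (≰⇒> d≰n) in contradiction q (height a c)

module Decide {S : FLBSig} (F : Structure S)
  (search : Searchable (Structure.Carrier F)) (_≟_ : DecidableEquality (Structure.Carrier F))
  (urel? : ∀ R → Decidable (Structure.urelI F R))
  (brel? : ∀ R a b → Dec (Structure.brelI F R a b)) where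
  open Structure F

  Edge? : ∀ a b → Dec (Edge F a b)
  Edge? a b = any? λ i → (funI (f i) a ≟ b) ×-dec ¬? (a ≟ b)

  Path? : ∀ a b l → Dec (Path F a b l)
  Path? a b zero = map′ (λ { refl → stop }) (Path-zero⇒≡ F) (a ≟ b)
  Path? a b (suc l) = map′ (λ (c , e , p) → step e p) (λ { (step e p) → _ , e , p })
                           (search λ c → Edge? a c ×-dec Path? c b l)

  Sat? : ∀ {k} (ρ : Fin k → Carrier) φ → Dec (Sat F ρ φ)
  Sat? ρ tt = yes tt
  Sat? ρ ff = no λ ()
  Sat? ρ (urel R t) = urel? R _
  Sat? ρ (brel R t u) = brel? R _ _
  Sat? ρ (t ≐ u) = _ ≟ _
  Sat? ρ (~ φ) = ¬? (Sat? ρ φ)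
  Sat? ρ (φ ∧' ψ) = Sat? ρ φ ×-dec Sat? ρ ψ
  Sat? ρ (φ ∨' ψ) = Sat? ρ φ ⊎-dec Sat? ρ ψ
  Sat? ρ (φ ⇒' ψ) = Sat? ρ φ →-dec Sat? ρ ψ
  Sat? ρ (∀' φ) = ∀? search λ a → Sat? (extend F ρ a) φ
  Sat? ρ (∃' φ) = search λ a → Sat? (extend F ρ a) φ

  ParentStep? : ∀ a b → Dec (ParentStep F a b)
  ParentStep? a b = (funI parent a ≟ b) ×-dec ¬? (a ≟ b)

  ParentOK? : Dec (ParentOK F)
  ParentOK? =
    (∀? search λ a → ∀? search λ b →
       (ParentStep? a b →-dec Edge? b a) ×-dec (Edge? b a →-dec ParentStep? a b))
    ×-dec
    (∀? search λ a → (∀? search λ b → ¬? (Edge? b a)) →-dec (funI parent a ≟ a))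

  SymFun? : ∀ R → Dec (SymFun F R)
  SymFun? R =
    (∀? search λ a → ∀? search λ b → brel? R a b →-dec brel? R b a)
    ×-dec
    (∀? search λ a → ∀? search λ b → ∀? search λ c →
       brel? R a b →-dec (brel? R a c →-dec (b ≟ c)))

  HeightAtMost? : ∀ n → Dec (HeightAtMost F n)
  HeightAtMost? n = ∀? search λ a → ∀? search λ b → ¬? (Path? a b (suc n))

  IsNFLB? : ∀ n → Dec (IsNFLB F n)
  IsNFLB? n =
    map′ (λ (unique , height , parentOK , link , link⋆) →
            ((unique , HeightAtMost⇒acyclic F height) , parentOK , link , link⋆) , height)
         (λ (((unique , _) , parentOK , link , link⋆) , height) →
            unique , height , parentOK , link , link⋆)
         ((∀? search λ a → ∀? search λ b → ∀? search λ c →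
             Edge? b a →-dec (Edge? c a →-dec (b ≟ c)))
          ×-dec HeightAtMost? n ×-dec ParentOK? ×-dec SymFun? Link ×-dec SymFun? Link⋆)

  Supported? : Dec (Supported F)
  Supported? = ∀? search λ a → urel? P a ⊎-dec urel? P⋆ a

-- Finite structures presented by tables

record Code (S : FLBSig) (M : ℕ) : Set where
  field
    P-table P⋆-table : Vec Bool M
    L-table L⋆-table : Vec (Vec Bool M) (nL S)
    N-table : Vec (Vec Bool M) (nN S)
    Link-table Link⋆-table : Vec (Vec Bool M) M
    f-table : Vec (Vec (Fin M) M) (nf S)
    parent-table : Vec (Fin M) M

module _ {S : FLBSig} {M : ℕ} where

  unaryOf : Code S M → URel S → Fin M → Bool
  unaryOf c P = lookup (Code.P-table c)
  unaryOf c P⋆ = lookup (Code.P⋆-table c)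
  unaryOf c (L j) = lookup (lookup (Code.L-table c) j)
  unaryOf c (L⋆ j) = lookup (lookup (Code.L⋆-table c) j)
  unaryOf c (N j) = lookup (lookup (Code.N-table c) j)

  binaryOf : Code S M → BRel → Fin M → Fin M → Bool
  binaryOf c Link = lookup ∘ lookup (Code.Link-table c)
  binaryOf c Link⋆ = lookup ∘ lookup (Code.Link⋆-table c)

  functionOf : Code S M → Fun S → Fin M → Fin M
  functionOf c (f j) = lookup (lookup (Code.f-table c) j)
  functionOf c parent = lookup (Code.parent-table c)

  tabulateCode : (URel S → Fin M → Bool) → (BRel → Fin M → Fin M → Bool) →
                 (Fun S → Fin M → Fin M) → Code S M
  tabulateCode u b g = record
    { P-table = tabulate (u P)
    ; P⋆-table = tabulate (u P⋆)
    ; L-table = tabulate λ j → tabulate (u (L j))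
    ; L⋆-table = tabulate λ j → tabulate (u (L⋆ j))
    ; N-table = tabulate λ j → tabulate (u (N j))
    ; Link-table = tabulate (tabulate ∘ b Link)
    ; Link⋆-table = tabulate (tabulate ∘ b Link⋆)
    ; f-table = tabulate λ j → tabulate (g (f j))
    ; parent-table = tabulate (g parent)
    }

  lookup²∘tabulate² : ∀ {A : Set} {K} (t : Fin K → Fin M → A) j i →
                      lookup (lookup (tabulate (tabulate ∘ t)) j) i ≡ t j i
  lookup²∘tabulate² t j i =
    trans (cong (λ row → lookup row i) (lookup∘tabulate (tabulate ∘ t) j)) (lookup∘tabulate (t j) i)

  module _ (u : URel S → Fin M → Bool) (b : BRel → Fin M → Fin M → Bool)
           (g : Fun S → Fin M → Fin M) where

    unaryOf-tabulate : ∀ R i → unaryOf (tabulateCode u b g) R i ≡ u R i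
    unaryOf-tabulate P = lookup∘tabulate (u P)
    unaryOf-tabulate P⋆ = lookup∘tabulate (u P⋆)
    unaryOf-tabulate (L j) = lookup²∘tabulate² (u ∘ L) j
    unaryOf-tabulate (L⋆ j) = lookup²∘tabulate² (u ∘ L⋆) j
    unaryOf-tabulate (N j) = lookup²∘tabulate² (u ∘ N) j

    binaryOf-tabulate : ∀ R i i′ → binaryOf (tabulateCode u b g) R i i′ ≡ b R i i′
    binaryOf-tabulate Link = lookup²∘tabulate² (b Link)
    binaryOf-tabulate Link⋆ = lookup²∘tabulate² (b Link⋆)

    functionOf-tabulate : ∀ h i → functionOf (tabulateCode u b g) h i ≡ g h i
    functionOf-tabulate (f j) = lookup²∘tabulate² (g ∘ f) j
    functionOf-tabulate parent = lookup∘tabulate (g parent)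

search-Code : ∀ S M → Searchable (Code S M)
search-Code S M Q? =
  map′ (λ (t , q) → toCode t , q) (λ (c , q) → fromCode c , q) (search-tables (Q? ∘ toCode))
  where
  open Code
  Tables : Set
  Tables = Vec Bool M × Vec Bool M × Vec (Vec Bool M) (nL S) × Vec (Vec Bool M) (nL S)
         × Vec (Vec Bool M) (nN S) × Vec (Vec Bool M) M × Vec (Vec Bool M) M
         × Vec (Vec (Fin M) M) (nf S) × Vec (Fin M) M

  toCode : Tables → Code S M
  toCode (p , p⋆ , l , l⋆ , nn , link , link⋆ , fs , par) =
    record { P-table = p ; P⋆-table = p⋆ ; L-table = l ; L⋆-table = l⋆ ; N-table = nn
           ; Link-table = link ; Link⋆-table = link⋆ ; f-table = fs ; parent-table = par }

  fromCode : Code S M → Tables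
  fromCode c = P-table c , P⋆-table c , L-table c , L⋆-table c , N-table c
             , Link-table c , Link⋆-table c , f-table c , parent-table c

  search-tables : Searchable Tables
  search-tables =
    search-× rows (search-× rows (search-× (search-Vec rows _) (search-× (search-Vec rows _)
      (search-× (search-Vec rows _) (search-× (search-Vec rows _) (search-× (search-Vec rows _)
      (search-× (search-Vec (search-Vec any? M) _) (search-Vec any? M))))))))
    where
    rows : Searchable (Vec Bool M)
    rows = search-Vec search-Bool M

decode : ∀ {S m} → Code S (suc m) → Structure S
decode {m = m} c = record
  { Carrier = Fin (suc m)
  ; inhabitant = zero
  ; urelI = λ R i → T (unaryOf c R i)
  ; brelI = λ R i i′ → T (binaryOf c R i i′)
  ; funI = functionOf c
  }

IsSupportedModel : ∀ {S} → ℕ → Sentence S → Structure S → Set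
IsSupportedModel n φ A = IsNFLB A n × Supported A × Models A φ

IsSupportedModel? : ∀ {S m} n φ (c : Code S (suc m)) → Dec (IsSupportedModel n φ (decode c))
IsSupportedModel? n φ c = IsNFLB? n ×-dec Supported? ×-dec Sat? (λ ()) φ
  where open Decide (decode c) any? _≟ᶠ_ (λ R i → T? _) (λ R i i′ → T? _)

-- Embeddings

record Embedding {S : FLBSig} (F A : Structure S) : Set where
  private
    module F = Structure F
    module A = Structure A
  field
    emb : F.Carrier → A.Carrier
    emb-injective : ∀ {x y} → emb x ≡ emb y → x ≡ y
    emb-funI : ∀ g x → emb (F.funI g x) ≡ A.funI g (emb x)
    emb-urelI : ∀ R x → F.urelI R x ⇔ A.urelI R (emb x)
    emb-brelI : ∀ R x y → F.brelI R x y ⇔ A.brelI R (emb x) (emb y)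

leadingExists : ∀ {S k} → Formula S k → ℕ
leadingExists (∃' φ) = suc (leadingExists φ)
leadingExists _ = zero

module _ {S : FLBSig} (A : Structure S) where
  open Structure A

  witnesses : ∀ {k} {φ : Formula S k} {σ} → IsExistsForallPrenex φ → Sat A σ φ → List Carrier
  witnesses (univ _) _ = []
  witnesses (ex p) (x , s) = x ∷ witnesses p s

  length-witnesses≤ : ∀ {k} {φ : Formula S k} {σ} (p : IsExistsForallPrenex φ) (s : Sat A σ φ) →
                      length (witnesses p s) ≤ leadingExists φ
  length-witnesses≤ (univ _) _ = z≤n
  length-witnesses≤ (ex p) (_ , s) = s≤s (length-witnesses≤ p s)

module _ {S : FLBSig} {F A : Structure S} (E : Embedding F A) where
  private
    module F = Structure F
    module A = Structure A
  open Embedding E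

  ≡⇔emb-≡ : ∀ {x y} → x ≡ y ⇔ emb x ≡ emb y
  ≡⇔emb-≡ = mk⇔ (cong emb) emb-injective

  Edge⇔emb-Edge : ∀ {a b} → Edge F a b ⇔ Edge A (emb a) (emb b)
  Edge⇔emb-Edge = mk⇔
    (λ (i , fa≡b , a≢b) → i , trans (sym (emb-funI (f i) _)) (cong emb fa≡b) , a≢b ∘ emb-injective)
    (λ (i , fa≡b , a≢b) → i , emb-injective (trans (emb-funI (f i) _) fa≡b) , a≢b ∘ cong emb)

  ParentStep⇔emb-ParentStep : ∀ {a b} → ParentStep F a b ⇔ ParentStep A (emb a) (emb b)
  ParentStep⇔emb-ParentStep = mk⇔
    (λ (pa≡b , a≢b) → trans (sym (emb-funI parent _)) (cong emb pa≡b) , a≢b ∘ emb-injective)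
    (λ (pa≡b , a≢b) → emb-injective (trans (emb-funI parent _) pa≡b) , a≢b ∘ cong emb)

  emb-Path : ∀ {a b l} → Path F a b l → Path A (emb a) (emb b) l
  emb-Path stop = stop
  emb-Path (step e p) = step (to Edge⇔emb-Edge e) (emb-Path p)

  emb-reflects-IsForest : IsForest A → IsForest F
  emb-reflects-IsForest (unique , acyclic) =
    (λ a b c e e′ → emb-injective (unique _ _ _ (to Edge⇔emb-Edge e) (to Edge⇔emb-Edge e′))) ,
    (λ a l → acyclic (emb a) l ∘ emb-Path)

  emb-reflects-ParentOK : DecidableEquality F.Carrier → ParentOK A → ParentOK F
  emb-reflects-ParentOK _≟_ (step⇔edge , roots) =
    (λ a b → let (step⇒edge , edge⇒step) = step⇔edge (emb a) (emb b) in
       from Edge⇔emb-Edge ∘ step⇒edge ∘ to ParentStep⇔emb-ParentStep ,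
       from ParentStep⇔emb-ParentStep ∘ edge⇒step ∘ to Edge⇔emb-Edge) ,
    root
    where
    root : ∀ a → (∀ b → ¬ Edge F b a) → F.funI parent a ≡ a
    root a no-edge with F.funI parent a ≟ a
    ... | yes pa≡a = pa≡a
    ... | no pa≢a = contradiction
      (from Edge⇔emb-Edge (proj₁ (step⇔edge (emb a) _) (to ParentStep⇔emb-ParentStep (refl , pa≢a ∘ sym))))
      (no-edge _)

  emb-reflects-SymFun : ∀ R → SymFun A R → SymFun F R
  emb-reflects-SymFun R (symmetric , functional) =
    (λ a b → from (emb-brelI R b a) ∘ symmetric _ _ ∘ to (emb-brelI R a b)) ,
    (λ a b c r r′ → emb-injective (functional _ _ _ (to (emb-brelI R a b) r) (to (emb-brelI R a c) r′)))

  emb-reflects-IsNFLB : DecidableEquality F.Carrier → ∀ {n} → IsNFLB A n → IsNFLB F n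
  emb-reflects-IsNFLB _≟_ ((forest , parentOK , link , link⋆) , height) =
    ( emb-reflects-IsForest forest , emb-reflects-ParentOK _≟_ parentOK
    , emb-reflects-SymFun Link link , emb-reflects-SymFun Link⋆ link⋆ ) ,
    λ a b → height (emb a) (emb b) ∘ emb-Path

  emb-reflects-Supported : Supported A → Supported F
  emb-reflects-Supported supported a =
    Sum.map (from (emb-urelI P a)) (from (emb-urelI P⋆ a)) (supported (emb a))

  module _ {k} {ρ : Fin k → F.Carrier} {σ : Fin k → A.Carrier} (ρ~σ : emb ∘ ρ ≗ σ) where

    emb-evalT : ∀ t → emb (evalT F ρ t) ≡ evalT A σ t
    emb-evalT (var i) = ρ~σ i
    emb-evalT (app g t) = trans (emb-funI g _) (cong (A.funI g) (emb-evalT t))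

    Sat⇔emb-Sat : ∀ {ψ : Formula S k} → IsQF ψ → Sat F ρ ψ ⇔ Sat A σ ψ
    Sat⇔emb-Sat tt = ⇔-refl
    Sat⇔emb-Sat ff = ⇔-refl
    Sat⇔emb-Sat (urel R t) = subst (λ x → _ ⇔ A.urelI R x) (emb-evalT t) (emb-urelI R _)
    Sat⇔emb-Sat (brel R t u) =
      subst₂ (λ x y → _ ⇔ A.brelI R x y) (emb-evalT t) (emb-evalT u) (emb-brelI R _ _)
    Sat⇔emb-Sat (eq t u) = subst₂ (λ x y → _ ⇔ x ≡ y) (emb-evalT t) (emb-evalT u) ≡⇔emb-≡
    Sat⇔emb-Sat (neg q) = ¬-cong-⇔ (Sat⇔emb-Sat q)
    Sat⇔emb-Sat (and q q′) = Sat⇔emb-Sat q ×-⇔ Sat⇔emb-Sat q′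
    Sat⇔emb-Sat (or q q′) = Sat⇔emb-Sat q ⊎-⇔ Sat⇔emb-Sat q′
    Sat⇔emb-Sat (imp q q′) = →-cong-⇔ (Sat⇔emb-Sat q) (Sat⇔emb-Sat q′)

  emb-extend : ∀ {k} {ρ : Fin k → F.Carrier} {σ} → emb ∘ ρ ≗ σ →
               ∀ x → emb ∘ extend F ρ x ≗ extend A σ (emb x)
  emb-extend ρ~σ x zero = refl
  emb-extend ρ~σ x (suc i) = ρ~σ i

  emb-reflects-∀-prenex : ∀ {k} {ψ : Formula S k} {ρ σ} → IsForallPrenex ψ → emb ∘ ρ ≗ σ →
                          Sat A σ ψ → Sat F ρ ψ
  emb-reflects-∀-prenex (qf q) ρ~σ = from (Sat⇔emb-Sat ρ~σ q)
  emb-reflects-∀-prenex (all p) ρ~σ s x = emb-reflects-∀-prenex p (emb-extend ρ~σ x) (s (emb x))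

  InImage : A.Carrier → Set
  InImage y = ∃ λ x → emb x ≡ y

  emb-reflects-∃∀-prenex : ∀ {k} {φ : Formula S k} {ρ σ} (p : IsExistsForallPrenex φ) (s : Sat A σ φ) →
                           All InImage (witnesses A p s) → emb ∘ ρ ≗ σ → Sat F ρ φ
  emb-reflects-∃∀-prenex (univ p) s _ ρ~σ = emb-reflects-∀-prenex p ρ~σ s
  emb-reflects-∃∀-prenex (ex p) (_ , s) ((x , refl) ∷ covered) ρ~σ =
    x , emb-reflects-∃∀-prenex p s covered (emb-extend ρ~σ x)

  emb-reflects-IsSupportedModel : DecidableEquality F.Carrier → ∀ {n} {φ : Sentence S} →
    (p : IsExistsForallPrenex φ) → IsNFLB A n → Supported A → (A⊨φ : Models A φ) →
    All InImage (witnesses A p A⊨φ) → IsSupportedModel n φ F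
  emb-reflects-IsSupportedModel _≟_ p nflb supported A⊨φ covered =
    emb-reflects-IsNFLB _≟_ nflb , emb-reflects-Supported supported ,
    emb-reflects-∃∀-prenex p A⊨φ covered λ ()

T-isYes⇔ : ∀ {X : Set} {b} (d : Dec X) → b ≡ isYes d → T b ⇔ X
T-isYes⇔ d refl = mk⇔ toWitness fromWitness

module _ {S : FLBSig} (A : Structure S) {m} (h : Fin (suc m) → Structure.Carrier A)
  (closed : ∀ g i → ∃ λ k → h k ≡ Structure.funI A g (h i))
  (urel? : ∀ R i → Dec (Structure.urelI A R (h i)))
  (brel? : ∀ R i j → Dec (Structure.brelI A R (h i) (h j))) where

  private
    unaryTable : URel S → Fin (suc m) → Bool
    unaryTable R i = isYes (urel? R i)

    binaryTable : BRel → Fin (suc m) → Fin (suc m) → Bool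
    binaryTable R i j = isYes (brel? R i j)

    functionTable : Fun S → Fin (suc m) → Fin (suc m)
    functionTable g i = proj₁ (closed g i)

  tabulatedCode : Code S (suc m)
  tabulatedCode = tabulateCode unaryTable binaryTable functionTable

  tabulated-embedding : (∀ {i j} → h i ≡ h j → i ≡ j) → Embedding (decode tabulatedCode) A
  tabulated-embedding h-injective = record
    { emb = h
    ; emb-injective = h-injective
    ; emb-funI = λ g i →
        trans (cong h (functionOf-tabulate unaryTable binaryTable functionTable g i)) (proj₂ (closed g i))
    ; emb-urelI = λ R i →
        T-isYes⇔ (urel? R i) (unaryOf-tabulate unaryTable binaryTable functionTable R i)
    ; emb-brelI = λ R i j →
        T-isYes⇔ (brel? R i j) (binaryOf-tabulate unaryTable binaryTable functionTable R i j)
    }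

-- Trees of an n-FLB

module Trees {S : FLBSig} (A : Structure S) {n} (nflb : IsNFLB A n) where
  open Structure A
  private
    edge⇒parentStep : ∀ a b → Edge A b a → ParentStep A a b
    edge⇒parentStep a b = proj₂ (proj₁ (proj₁ (proj₂ (proj₁ nflb))) a b)

    parentStep⇒edge : ∀ a b → ParentStep A a b → Edge A b a
    parentStep⇒edge a b = proj₁ (proj₁ (proj₁ (proj₂ (proj₁ nflb))) a b)

    height : HeightAtMost A n
    height = proj₂ nflb

  IsRoot : Carrier → Set
  IsRoot r = funI parent r ≡ r

  Reachable : Carrier → Carrier → Set
  Reachable r y = ∃ (Path A r y)

  f-reachable : ∀ {r y} → Reachable r y → ∀ i → ¬ ¬ Reachable r (funI (f i) y)
  f-reachable {r} {y} (d , p) i = reach <$> ¬¬-excluded-middle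
    where
    reach : Dec (funI (f i) y ≡ y) → Reachable r (funI (f i) y)
    reach (yes fy≡y) = d , subst (λ z → Path A r z d) (sym fy≡y) p
    reach (no fy≢y) = suc d , (A ▷ p) (i , refl , fy≢y ∘ sym)

  parent-reachable : ∀ {r y} → IsRoot r → Reachable r y → Reachable r (funI parent y)
  parent-reachable {r} r-root (zero , p) with refl ← Path-zero⇒≡ A p =
    zero , subst (λ z → Path A r z zero) (sym r-root) stop
  parent-reachable {r} {y} r-root (suc d , p) =
    let (b , q , e) = unsnoc A p in
    d , subst (λ z → Path A r z d) (sym (proj₁ (edge⇒parentStep y b e))) q

  fun-reachable : ∀ {r y} → IsRoot r → Reachable r y → ∀ g → ¬ ¬ Reachable r (funI g y)
  fun-reachable _ reach (f i) = f-reachable reach i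
  fun-reachable r-root reach parent = pure (parent-reachable r-root reach)

  ancestor : ℕ → Carrier → Carrier
  ancestor m x = fold x (funI parent) m

  ancestor-reaches : ∀ m x → ¬ ¬ ∃ λ d → Path A (ancestor m x) x d × (IsRoot (ancestor m x) ⊎ d ≡ m)
  ancestor-reaches zero x = pure (0 , stop , inj₂ refl)
  ancestor-reaches (suc m) x = do
    (d , p , root-or-length) ← ancestor-reaches m x
    root? ← ¬¬-excluded-middle
    pure (climb p root-or-length root?)
    where
    a = ancestor m x
    climb : ∀ {d} → Path A a x d → IsRoot a ⊎ d ≡ m → Dec (IsRoot a) →
            ∃ λ d′ → Path A (funI parent a) x d′ × (IsRoot (funI parent a) ⊎ d′ ≡ suc m)
    climb p _ (yes a-root) =
      _ , subst (λ z → Path A z x _) (sym a-root) p , inj₁ (cong (funI parent) a-root)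
    climb p (inj₁ a-root) (no a-not-root) = contradiction a-root a-not-root
    climb p (inj₂ refl) (no a-not-root) =
      _ , step (parentStep⇒edge a _ (refl , a-not-root ∘ sym)) p , inj₂ refl

  root : Carrier → Carrier
  root = ancestor (suc n)

  root-reaches : ∀ x → ¬ ¬ (IsRoot (root x) × Reachable (root x) x)
  root-reaches x = ancestor-reaches (suc n) x >>= λ
    { (d , p , inj₁ r-root) → pure (r-root , d , p)
    ; (d , p , inj₂ refl) → contradiction p (height _ x) }

  -- letter zero stays put, so words of length n describe all paths of length at most n
  Letter : Set
  Letter = Fin (suc (nf S))

  act : Letter → Carrier → Carrier
  act zero = id
  act (suc i) = funI (f i)

  run : ∀ {m} → Vec Letter m → Carrier → Carrier
  run [] x = x
  run (l ∷ v) x = run v (act l x)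

  run-reachable : ∀ {r x m} → Reachable r x → (v : Vec Letter m) → ¬ ¬ Reachable r (run v x)
  run-reachable reach [] = pure reach
  run-reachable reach (zero ∷ v) = run-reachable reach v
  run-reachable reach (suc i ∷ v) = f-reachable reach i >>= λ reach′ → run-reachable reach′ v

  path⇒word : ∀ {x y d m} → Path A x y d → d ≤ m → ∃ λ (v : Vec Letter m) → run v x ≡ y
  path⇒word {m = zero} stop z≤n = [] , refl
  path⇒word {m = suc m} stop z≤n = let (v , e) = path⇒word stop z≤n in zero ∷ v , e
  path⇒word (step (i , fx≡b , _) p) (s≤s d≤m) =
    let (v , e) = path⇒word p d≤m in suc i ∷ v , trans (cong (run v) fx≡b) e

  words : List (Vec Letter n)
  words = allVecs (suc (nf S)) n

  closure : List Carrier → List Carrier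
  closure ws = cartesianProductWith (λ w v → run v (root w)) ws words

  length-closure : ∀ ws → length (closure ws) ≡ length ws * length words
  length-closure ws = length-cartesianProductWith _ ws words

  ∈-closure⁺ : ∀ {w ws y} → w ∈ ws → Reachable (root w) y → y ∈ closure ws
  ∈-closure⁺ {ws = ws} w∈ (d , p) =
    let (v , e) = path⇒word p (HeightAtMost⇒length≤ A height p) in
    subst (_∈ closure ws) e (∈-cartesianProductWith⁺ _ w∈ (∈-allVecs v))

  ⊆-closure : ∀ {w ws} → w ∈ ws → ¬ ¬ (w ∈ closure ws)
  ⊆-closure {w} w∈ = do
    (_ , reach) ← root-reaches w
    pure (∈-closure⁺ w∈ reach)

  closure-closed : ∀ {ws y} → y ∈ closure ws → ∀ g → ¬ ¬ (funI g y ∈ closure ws)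
  closure-closed {ws} y∈ g with ∈-cartesianProductWith⁻ _ ws words y∈
  ... | w , v , w∈ , _ , refl = do
    (w-root , _) ← root-reaches w
    reach ← run-reachable (0 , stop) v
    reach′ ← fun-reachable w-root reach g
    pure (∈-closure⁺ w∈ reach′)

-- Small model property

modelBound : ∀ {S} → ℕ → Sentence S → ℕ
modelBound {S} n φ = suc (leadingExists φ) * length (allVecs (suc (nf S)) n)

SmallSupportedModel : ∀ {S} → ℕ → Sentence S → Set
SmallSupportedModel {S} n φ =
  ∃ λ m → m < modelBound n φ × Σ (Code S (suc m)) (IsSupportedModel n φ ∘ decode)

SmallSupportedModel? : ∀ {S} n (φ : Sentence S) → Dec (SmallSupportedModel n φ)
SmallSupportedModel? {S} n φ =
  anyUpTo? (λ m → search-Code S (suc m) (IsSupportedModel? n φ)) (modelBound n φ)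

small-model-property : ∀ {S n} {φ : Sentence S} {A} → IsExistsForallPrenex φ →
                       IsSupportedModel n φ A → ¬ ¬ SmallSupportedModel n φ
small-model-property {S} {n} {φ} {A} p (nflb , supported , A⊨φ) = do
  (_ , I) ← ¬¬-injectiveIndexing domain
  model-from-indexing I
  where
  open Structure A
  open Trees A nflb

  seeds : List Carrier
  seeds = inhabitant ∷ witnesses A p A⊨φ

  domain : List Carrier
  domain = closure seeds

  model-from-indexing : ∀ {size} → InjectiveIndexing domain size → ¬ ¬ SmallSupportedModel n φ
  model-from-indexing {zero} I = do
    inhabitant∈ ← ⊆-closure {ws = seeds} (here refl)
    contradiction (proj₁ (InjectiveIndexing.index-surjective I inhabitant∈)) ¬Fin0
  model-from-indexing {suc m} I = do
    closed ← ¬¬-Π-Fun λ g → ¬¬-Π-Fin λ i → index-surjective <$> closure-closed {ws = seeds} (index-∈ i) g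
    urel? ← ¬¬-Π-URel λ R → ¬¬-Π-Fin λ i → ¬¬-excluded-middle
    brel? ← ¬¬-Π-BRel λ R → ¬¬-Π-Fin λ i → ¬¬-Π-Fin λ j → ¬¬-excluded-middle
    witnesses∈ ← All.sequenceM 0ℓ ¬¬-Monad (All.tabulate λ x∈ → ⊆-closure {ws = seeds} (there x∈))
    pure ( m , size≤bound , tabulatedCode A index closed urel? brel?
         , emb-reflects-IsSupportedModel (tabulated-embedding A index closed urel? brel? index-injective)
             _≟ᶠ_ p nflb supported A⊨φ (All.map index-surjective witnesses∈) )
    where
    open InjectiveIndexing I

    size≤bound : suc m ≤ modelBound n φ
    size≤bound = ≤-trans size≤length (≤-trans (≤-reflexive (length-closure seeds))
                   (*-monoˡ-≤ (length words) (s≤s (length-witnesses≤ A p A⊨φ))))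

theorem3p3 : (n : ℕ) (S : FLBSig) (φ : Sentence S) →
             IsExistsForallPrenex φ → Dec (SatModuloTsupp n φ)
theorem3p3 n S φ p = map′ small⇒model model⇒small small?
  where
  small? : Dec (SmallSupportedModel n φ)
  small? = SmallSupportedModel? n φ

  small⇒model : SmallSupportedModel n φ → SatModuloTsupp n φ
  small⇒model (_ , _ , c , c-model) = decode c , c-model

  model⇒small : SatModuloTsupp n φ → SmallSupportedModel n φ
  model⇒small (A , A-model) = decidable-stable small? (small-model-property p A-model)
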